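{- Fix a nonempty finite set $S$ of consecutive positive integers and a link-offset set $\Delta$. Let $M = \{\min(S_{\Delta i\sigma}) : S_{\Delta i\sigma} \neq \emptyset\}$. Then $M \subseteq S$ and $M$ contains no elements other than: (1) $\min(S)$; (2) $\Delta_i$ for each $i > 0$; (3) $\Delta_i + 1$ for each $i > 0$; and (4) at most one of $\beta_i$ or $\beta_i + 1$ for each $i > 0$, where case (4) occurs only with two-sided routing. Symmetrically, if $S$ is a nonempty finite set of consecutive negative integers and $M = \{\max(S_{\Delta i\sigma}) : S_{\Delta i\sigma} \neq \emptyset\}$, then $M \subseteq S$ and $M$ contains no elements other than $\max(S)$, $\Delta_{ -i}$ and $\Delta_{ -i}-1$ for each $i>0$, and at most one of $\beta_{ -i}$ or $\beta_{ -i}-1$ for each $i>0$, the last case only with two-sided routing.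
   Context: Nodes are labeled by the integers and the routing target is $0$. A link-offset set $\Delta$ is a finite set of nonzero integers containing $-1$ and $+1$; a node $x$ has outgoing links to $x - \delta$ for $\delta \in \Delta$. Write $\Delta = \{\Delta_{ -s} < \cdots < \Delta_{ -1} = -1 < \Delta_1 = 1 < \cdots < \Delta_t\}$, and set $\Delta_{ -i} = -\infty$ for $i > s$ and $\Delta_i = +\infty$ for $i > t$. For $i > 0$ define $\beta_i = \lceil (\Delta_i + \Delta_{i+1})/2 \rceil$ and $\beta_{ -i} = \lfloor (\Delta_{ -i} + \Delta_{ -i-1})/2 \rfloor$ (when finite). Successor function $s(x,\Delta)$: in one-sided greedy routing, from $x$ the message moves to the node $x - \Delta_i$ with the smallest non-negative label; in two-sided greedy routing it moves to a node $x - \Delta_i$ whose label has smallest absolute value, ties broken by a fixed arbitrary rule. For $S$ as in the claim, $S_{\Delta i} = \{x \in S : s(x,\Delta) = x - \Delta_i\}$ and for $\sigma \in \{ -,0,+\}$, $S_{\Delta i\sigma} = \{x \in S_{\Delta i} : \operatorname{sgn} s(x,\Delta) = \sigma\}$. -}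

module Defs where

open import Data.Nat using (ℕ)
open import Data.Integer using (ℤ; +_; -_; _+_; _-_; _≤_; _<_; ∣_∣; _/ℕ_; 0ℤ; 1ℤ)
open import Data.List using (List)
open import Data.List.Membership.Propositional using (_∈_)
open import Data.Product using (_×_; Σ; ∃; ∃-syntax)
open import Data.Sum using (_⊎_)
open import Relation.Binary.PropositionalEquality using (_≡_)
open import Relation.Nullary using (¬_)
open import Data.Empty using (⊥)
import Data.Nat as ℕ

-- A link-offset set Δ is a finite set of nonzero integers containing -1 and +1.
-- It is represented by a list (duplicates are harmless: only membership is used).
record LinkOffsets : Set where
  field
    offs    : List ℤ
    no-zero : ¬ (0ℤ ∈ offs)
    has+1   : 1ℤ ∈ offs
    has-1   : (- 1ℤ) ∈ offs
open LinkOffsets public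

⌊_/2⌋ : ℤ → ℤ
⌊ z /2⌋ = z /ℕ 2

⌈_/2⌉ : ℤ → ℤ
⌈ z /2⌉ = - ((- z) /ℕ 2)

-- δ' is the next element of Δ above δ  (δ = Δ_i, δ' = Δ_{i+1})
NextUp : LinkOffsets → ℤ → ℤ → Set
NextUp Δ δ δ' = δ ∈ offs Δ × δ' ∈ offs Δ × δ < δ'
              × (∀ e → e ∈ offs Δ → δ < e → e < δ' → ⊥)

-- δ' is the next element of Δ below δ  (δ = Δ_{-i}, δ' = Δ_{-i-1})
NextDown : LinkOffsets → ℤ → ℤ → Set
NextDown Δ δ δ' = δ ∈ offs Δ × δ' ∈ offs Δ × δ' < δ
                × (∀ e → e ∈ offs Δ → δ' < e → e < δ → ⊥)

data Mode : Set where
  oneSided twoSided : Mode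

-- GreedyStep m Δ x y : y is a legal greedy successor of x (routing target 0).
-- one-sided, x > 0 : y = x - δ (δ ∈ Δ) is the smallest non-negative label among the x - δ'.
-- one-sided, x < 0 : mirror image: y is the largest non-positive label.
-- two-sided        : y = x - δ has the smallest absolute value (any tie-breaking).
GreedyStep : Mode → LinkOffsets → ℤ → ℤ → Set
GreedyStep oneSided Δ x y =
  Σ ℤ (λ δ → δ ∈ offs Δ × y ≡ x - δ)
  × (0ℤ < x → 0ℤ ≤ y × (∀ δ' → δ' ∈ offs Δ → 0ℤ ≤ x - δ' → y ≤ x - δ'))
  × (x < 0ℤ → y ≤ 0ℤ × (∀ δ' → δ' ∈ offs Δ → x - δ' ≤ 0ℤ → x - δ' ≤ y))
GreedyStep twoSided Δ x y =
  Σ ℤ (λ δ → δ ∈ offs Δ × y ≡ x - δ)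
  × (∀ δ' → δ' ∈ offs Δ → ∣ y ∣ ℕ.≤ ∣ x - δ' ∣)

data Sgn : Set where
  neg zer pos : Sgn

HasSgn : ℤ → Sgn → Set
HasSgn z neg = z < 0ℤ
HasSgn z zer = z ≡ 0ℤ
HasSgn z pos = 0ℤ < z

InS : ℤ → ℤ → ℤ → Set
InS a b x = a ≤ x × x ≤ b

InSΔ : ℤ → ℤ → (ℤ → ℤ) → ℤ → Sgn → ℤ → Set
InSΔ a b s δ σ x = InS a b x × s x ≡ x - δ × HasSgn (s x) σ

InMmin : LinkOffsets → ℤ → ℤ → (ℤ → ℤ) → ℤ → Set
InMmin Δ a b s m = ∃[ δ ] ∃[ σ ] (δ ∈ offs Δ × InSΔ a b s δ σ m
                     × (∀ y → InSΔ a b s δ σ y → m ≤ y))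

InMmax : LinkOffsets → ℤ → ℤ → (ℤ → ℤ) → ℤ → Set
InMmax Δ a b s m = ∃[ δ ] ∃[ σ ] (δ ∈ offs Δ × InSΔ a b s δ σ m
                     × (∀ y → InSΔ a b s δ σ y → y ≤ m))

TwoSided : Mode → Set
TwoSided m = m ≡ twoSided

{-# OPTIONS --safe #-}
-- Let m > min S be the minimum of S_{Δiσ}, with δ = Δ_i, and x = m - 1 its predecessor,
-- so that x ∉ S_{Δiσ}. If σ = 0 then m = δ, and if x = δ then m = δ + 1. Otherwise
-- compare the offsets chosen at x and at m: one-sided routing chooses the largest offset
-- not above the current node and two-sided routing a nearest one. For σ = + the choice at m
-- is also the choice at x, which would put x into S_{Δiσ}. For σ = - one-sided routing is
-- impossible, while two-sided routing must switch between x and m from an offset Δ_j to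
-- δ = Δ_{j+1}; this pins x and m around the midpoint β_j, and m is β_j or β_j + 1 according
-- to whether s routes β_j itself through Δ_{j+1}. Negating labels and offsets turns the
-- statement about maxima of negative intervals into the one about minima.
module Submission where

open import Defs
open import Data.Integer using (ℤ; _+_; _-_; _≤_; _<_; 0ℤ; 1ℤ)
open import Data.List.Membership.Propositional using (_∈_)
open import Data.Product using (_×_; Σ; ∃-syntax)
open import Data.Sum using (_⊎_)
open import Relation.Binary.PropositionalEquality using (_≡_)

open import Data.Bool using (if_then_else_)
open import Data.Empty using (⊥; ⊥-elim)
open import Data.Integer
  using (+_; -_; _*_; -[1+_]; ∣_∣; _/ℕ_; _≟_; _≤?_; _<?_; -≤+; +≤+)
open import Data.Integer.DivMod using ([n/ℕd]*d≤n; n<s[n/ℕd]*d)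
open import Data.Integer.Properties
open import Data.Integer.Tactic.RingSolver using (solve; solve-∀)
open import Data.List using (List; []; _∷_; filter; map)
open import Data.List.Extrema ≤-totalOrder using (min; max; min≈v⁺; xs≤max)
open import Data.List.Membership.Propositional.Properties
  using (∈-filter⁺; ∈-filter⁻; ∈-map⁺; ∈-map⁻)
import Data.List.Relation.Unary.All as All
import Data.Nat as ℕ
open import Data.Product using (_,_; proj₁; proj₂)
import Data.Product as Prod
import Data.Sum as Sum
open import Data.Sum using (inj₁; inj₂)
open import Relation.Binary.PropositionalEquality
  using (_≢_; refl; sym; trans; cong; cong₂; subst; subst₂; ≢-sym; module ≡-Reasoning)
open import Relation.Nullary using (does; yes; no)
open import Relation.Nullary.Decidable using (dec-true; dec-false)

open ≡-Reasoning

-- Integer arithmetic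

-- A linear inequality is derived by writing its gap as a sum of gaps already known to be
-- nonnegative; the ring solver checks that identity.

infixl 6 _⊕_

_⊕_ : ∀ {u v} → 0ℤ ≤ u → 0ℤ ≤ v → 0ℤ ≤ u + v
_⊕_ = +-mono-≤

gap : ∀ {i j} → i ≤ j → 0ℤ ≤ j - i
gap = i≤j⇒0≤j-i

j-[1+i]≡j-i-1 : ∀ j i → j - (1ℤ + i) ≡ j - i - 1ℤ
j-[1+i]≡j-i-1 = solve-∀

gap< : ∀ {i j} → i < j → 0ℤ ≤ j - i - 1ℤ
gap< {i} {j} i<j = subst (0ℤ ≤_) (j-[1+i]≡j-i-1 j i) (gap (i<j⇒suc[i]≤j i<j))

≤-by : ∀ {u} i j → 0ℤ ≤ u → u ≡ j - i → i ≤ j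
≤-by i j 0≤u u≡ = 0≤i-j⇒j≤i (subst (0ℤ ≤_) u≡ 0≤u)

<-by : ∀ {u} i j → 0ℤ ≤ u → u ≡ j - i - 1ℤ → i < j
<-by i j 0≤u u≡ =
  suc[i]≤j⇒i<j (≤-by (1ℤ + i) j 0≤u (trans u≡ (sym (j-[1+i]≡j-i-1 j i))))

⊥-by : ∀ {u} n → 0ℤ ≤ u → u ≡ -[1+ n ] → ⊥
⊥-by n 0≤u u≡ with () ← subst (0ℤ ≤_) u≡ 0≤u

0<j-i : ∀ {i j} → i < j → 0ℤ < j - i
0<j-i {i} {j} i<j = <-by 0ℤ (j - i) (gap< i<j) (solve (i ∷ j ∷ []))

m-1<m : ∀ m → m - 1ℤ < m
m-1<m m = <-by (m - 1ℤ) m ≤-refl (solve (m ∷ []))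

i-j<0⇒i<j : ∀ {i j} → i - j < 0ℤ → i < j
i-j<0⇒i<j {i} {j} i-j<0 = <-by i j (gap< i-j<0) (solve (i ∷ j ∷ []))

sub-cancelˡ : ∀ x {p q} → x - p ≡ x - q → p ≡ q
sub-cancelˡ x {p} {q} e = begin
  p            ≡⟨ solve (x ∷ p ∷ []) ⟩
  x - (x - p)  ≡⟨ cong (λ r → x - r) e ⟩
  x - (x - q)  ≡⟨ solve (x ∷ q ∷ []) ⟩
  q            ∎

neg-sub : ∀ x δ → - (x - δ) ≡ - x - - δ
neg-sub x δ = neg-distrib-+ x (- δ)

neg-sub-neg : ∀ x δ → - (x - - δ) ≡ - x - δ
neg-sub-neg = solve-∀

neg-swap : ∀ {i j} → - i ≡ j → i ≡ - j
neg-swap {i} -i≡j = trans (sym (neg-involutive i)) (cong -_ -i≡j)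

<-neg : ∀ {i j} → i < - j → j < - i
<-neg {i} {j} i<-j = subst (_< - i) (neg-involutive j) (neg-mono-< i<-j)

neg-< : ∀ {i j} → - i < j → - j < i
neg-< {i} {j} -i<j = subst (- j <_) (neg-involutive i) (neg-mono-< -i<j)

i≤∣i∣ : ∀ i → i ≤ + ∣ i ∣ × - i ≤ + ∣ i ∣
i≤∣i∣ (+ n)    = ≤-refl , neg-≤-pos
i≤∣i∣ -[1+ n ] = -≤+ , ≤-refl

∣i∣≡-i : ∀ {i} → i ≤ 0ℤ → + ∣ i ∣ ≡ - i
∣i∣≡-i {i} i≤0 = trans (cong +_ (sym (∣-i∣≡∣i∣ i))) (0≤i⇒+∣i∣≡i (neg-mono-≤ i≤0))

ceil-half-unique : ∀ z t → t + t - 1ℤ ≤ z → z ≤ t + t → ⌈ z /2⌉ ≡ t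
ceil-half-unique z t lo hi =
  trans (cong -_ (floor-unique ([n/ℕd]*d≤n (- z) 2) (n<s[n/ℕd]*d (- z) 2)))
        (neg-involutive t)
  where
  floor-unique : ∀ {q} → q * + 2 ≤ - z → - z < (1ℤ + q) * + 2 → q ≡ - t
  floor-unique {q} below above = ≤-antisym
    (≮⇒≥ λ (-t<q : - t < q) →
      ⊥-by 0 (gap below ⊕ gap lo ⊕ gap< -t<q ⊕ gap< -t<q) (solve (z ∷ t ∷ q ∷ [])))
    (≮⇒≥ λ (q<-t : q < - t) →
      ⊥-by 0 (gap< above ⊕ gap hi ⊕ gap< q<-t ⊕ gap< q<-t) (solve (z ∷ t ∷ q ∷ [])))

neg-⌈neg/2⌉ : ∀ p q → - ⌈ - p + - q /2⌉ ≡ ⌊ p + q /2⌋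
neg-⌈neg/2⌉ p q = trans (neg-involutive ((- (- p + - q)) /ℕ 2))
  (cong (_/ℕ 2) (trans (neg-distrib-+ (- p) (- q))
                       (cong₂ _+_ (neg-involutive p) (neg-involutive q))))

-- Greedy steps in terms of offsets

Closer : ℤ → ℤ → ℤ → Set
Closer x p q = ∣ x - p ∣ ℕ.≤ ∣ x - q ∣

closer-bounds : ∀ {x p q} → Closer x p q → x - p ≤ + ∣ x - q ∣ × - (x - p) ≤ + ∣ x - q ∣
closer-bounds {x} {p} closer with i≤∣i∣ (x - p)
... | below , above = ≤-trans below (+≤+ closer) , ≤-trans above (+≤+ closer)

closer-than-below : ∀ {x p q} → q ≤ x → Closer x p q → q ≤ p × p + q ≤ x + x
closer-than-below {x} {p} {q} q≤x closer
  with closer-bounds {x} {p} {q} closer | 0≤i⇒+∣i∣≡i (gap q≤x)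
... | below , above | ∣x-q∣≡ =
  ≤-by q p (gap (subst (x - p ≤_) ∣x-q∣≡ below)) (solve (x ∷ p ∷ q ∷ [])) ,
  ≤-by (p + q) (x + x) (gap (subst (- (x - p) ≤_) ∣x-q∣≡ above)) (solve (x ∷ p ∷ q ∷ []))

closer-than-above : ∀ {x p q} → x ≤ q → Closer x p q → p ≤ q × x + x ≤ p + q
closer-than-above {x} {p} {q} x≤q closer
  with closer-bounds {x} {p} {q} closer
     | ∣i∣≡-i (≤-by (x - q) 0ℤ (gap x≤q) (solve (x ∷ q ∷ [])))
... | below , above | ∣x-q∣≡ =
  ≤-by p q (gap (subst (- (x - p) ≤_) ∣x-q∣≡ above)) (solve (x ∷ p ∷ q ∷ [])) ,
  ≤-by (x + x) (p + q) (gap (subst (x - p ≤_) ∣x-q∣≡ below)) (solve (x ∷ p ∷ q ∷ []))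

GreedyOn : Mode → LinkOffsets → (ℤ → ℤ) → ℤ → ℤ → Set
GreedyOn mode Δ s a b = ∀ x → InS a b x → GreedyStep mode Δ x (s x)

greedyStep-offset : ∀ mode {Δ x y} → GreedyStep mode Δ x y → ∃[ δ ] (δ ∈ offs Δ × y ≡ x - δ)
greedyStep-offset oneSided = proj₁
greedyStep-offset twoSided = proj₁

record LargestBelow (Δ : LinkOffsets) (x δ : ℤ) : Set where
  field
    below   : δ ≤ x
    largest : ∀ e → e ∈ offs Δ → e ≤ x → e ≤ δ

record Nearest (Δ : LinkOffsets) (x δ : ℤ) : Set where
  field
    closest : ∀ e → e ∈ offs Δ → Closer x δ e

open LargestBelow
open Nearest

oneSided-largestBelow : ∀ {Δ x y δ} → 0ℤ < x → GreedyStep oneSided Δ x y → y ≡ x - δ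
  → LargestBelow Δ x δ
oneSided-largestBelow {Δ} {x} {y} {δ} 0<x (_ , positive-x , _) y≡ with positive-x 0<x
... | 0≤y , minimal = record
  { below   = 0≤i-j⇒j≤i (subst (0ℤ ≤_) y≡ 0≤y)
  ; largest = λ e e∈ e≤x →
      ≤-by e δ (gap (subst (_≤ x - e) y≡ (minimal e e∈ (gap e≤x)))) (solve (x ∷ δ ∷ e ∷ []))
  }

twoSided-nearest : ∀ {Δ x y δ} → GreedyStep twoSided Δ x y → y ≡ x - δ → Nearest Δ x δ
twoSided-nearest (_ , shortest) y≡ = record
  { closest = λ e e∈ → subst (λ z → ∣ z ∣ ℕ.≤ _) y≡ (shortest e e∈) }

largestBelow-unique : ∀ {Δ x m δ₀ δ} → x ≤ m → δ ≤ x → δ₀ ∈ offs Δ → δ ∈ offs Δ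
  → LargestBelow Δ x δ₀ → LargestBelow Δ m δ → δ₀ ≡ δ
largestBelow-unique x≤m δ≤x δ₀∈ δ∈ at-x at-m =
  ≤-antisym (largest at-m _ δ₀∈ (≤-trans (below at-x) x≤m)) (largest at-x _ δ∈ δ≤x)

nearest-unique : ∀ {Δ x m δ₀ δ} → x < m → δ ≤ x → δ₀ ∈ offs Δ → δ ∈ offs Δ
  → Nearest Δ x δ₀ → Nearest Δ m δ → δ₀ ≡ δ
nearest-unique {x = x} {m} {δ₀} {δ} x<m δ≤x δ₀∈ δ∈ near-x near-m
  with closer-than-below δ≤x (closest near-x δ δ∈) | ≤-total δ₀ m
... | δ≤δ₀ , _ | inj₁ δ₀≤m =
  ≤-antisym (proj₁ (closer-than-below δ₀≤m (closest near-m δ₀ δ₀∈))) δ≤δ₀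
... | _ , δ₀+δ≤2x | inj₂ m≤δ₀ = ⊥-elim (⊥-by 1
  (gap δ₀+δ≤2x ⊕ gap (proj₂ (closer-than-above m≤δ₀ (closest near-m δ₀ δ₀∈)))
    ⊕ gap< x<m ⊕ gap< x<m)
  (solve (x ∷ m ∷ δ₀ ∷ δ ∷ [])))

nearest-switch : ∀ {Δ x m δ₀ δ} → x ≤ δ → δ₀ ≢ δ → δ₀ ∈ offs Δ → δ ∈ offs Δ
  → Nearest Δ x δ₀ → Nearest Δ m δ → δ₀ < δ × x + x ≤ δ₀ + δ × δ₀ + δ ≤ m + m
nearest-switch {x = x} {m} {δ₀} {δ} x≤δ δ₀≢δ δ₀∈ δ∈ near-x near-m
  with closer-than-above x≤δ (closest near-x δ δ∈) | ≤-total δ₀ m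
... | δ₀≤δ , 2x≤δ₀+δ | inj₁ δ₀≤m =
  ≤∧≢⇒< δ₀≤δ δ₀≢δ , 2x≤δ₀+δ ,
  subst (_≤ m + m) (+-comm δ δ₀) (proj₂ (closer-than-below δ₀≤m (closest near-m δ₀ δ₀∈)))
... | δ₀≤δ , _ | inj₂ m≤δ₀ =
  ⊥-elim (δ₀≢δ (≤-antisym δ₀≤δ (proj₁ (closer-than-above m≤δ₀ (closest near-m δ₀ δ₀∈)))))

nearest-switch-adjacent : ∀ {Δ m δ₀ δ} → m < δ → Nearest Δ (m - 1ℤ) δ₀ → Nearest Δ m δ
  → ∀ e → e ∈ offs Δ → δ₀ < e → e < δ → ⊥
nearest-switch-adjacent {m = m} {δ₀} {δ} m<δ near-x near-m e e∈ δ₀<e e<δ with ≤-total e m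
... | inj₁ e≤m = <⇒≱ δ₀<e (proj₁ (closer-than-below e≤x (closest near-x e e∈)))
  where
  e≤x : e ≤ m - 1ℤ
  e≤x = ≤-by e (m - 1ℤ) (gap (proj₂ (closer-than-below e≤m (closest near-m e e∈))) ⊕ gap< m<δ)
    (solve (m ∷ δ ∷ e ∷ []))
... | inj₂ m≤e = <⇒≱ e<δ (proj₁ (closer-than-above m≤e (closest near-m e e∈)))

nextAbove : List ℤ → ℤ → ℤ
nextAbove L δ = min (max δ L) (filter (δ <?_) L)

nextAbove-nextUp : ∀ {Δ δ δ'} → NextUp Δ δ δ' → nextAbove (offs Δ) δ ≡ δ'
nextAbove-nextUp {Δ} {δ} {δ'} (_ , δ'∈ , δ<δ' , gapless) =
  min≈v⁺ (∈-filter⁺ (δ <?_) δ'∈ δ<δ') (All.tabulate least)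
         (All.lookup (xs≤max δ (offs Δ)) δ'∈)
  where
  least : ∀ {e} → e ∈ filter (δ <?_) (offs Δ) → δ' ≤ e
  least e∈ with ∈-filter⁻ (δ <?_) {xs = offs Δ} e∈
  ... | e∈Δ , δ<e = ≮⇒≥ (gapless _ e∈Δ δ<e)

midpoint : ℤ → ℤ → ℤ
midpoint δ δ' = ⌈ δ + δ' /2⌉

boundary : (ℤ → ℤ) → ℤ → ℤ → ℤ
boundary s δ δ' =
  let β = midpoint δ δ' in if does (s β ≟ β - δ') then β else β + 1ℤ

boundary≡midpoint : ∀ s δ δ' → s (midpoint δ δ') ≡ midpoint δ δ' - δ'
  → boundary s δ δ' ≡ midpoint δ δ'
boundary≡midpoint s δ δ' e =
  cong (if_then midpoint δ δ' else midpoint δ δ' + 1ℤ) (dec-true (_ ≟ _) e)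

boundary≡midpoint+1 : ∀ s δ δ' → s (midpoint δ δ') ≢ midpoint δ δ' - δ'
  → boundary s δ δ' ≡ midpoint δ δ' + 1ℤ
boundary≡midpoint+1 s δ δ' ne =
  cong (if_then midpoint δ δ' else midpoint δ δ' + 1ℤ) (dec-false (_ ≟ _) ne)

boundary-cases : ∀ s δ δ' → boundary s δ δ' ≡ midpoint δ δ' ⊎ boundary s δ δ' ≡ midpoint δ δ' + 1ℤ
boundary-cases s δ δ' with s (midpoint δ δ') ≟ midpoint δ δ' - δ'
... | yes _ = inj₁ refl
... | no _  = inj₂ refl

boundary-between : ∀ {s δ δ' m} → (m - 1ℤ) + (m - 1ℤ) ≤ δ + δ' → δ + δ' ≤ m + m
  → s m ≡ m - δ' → s (m - 1ℤ) ≢ m - 1ℤ - δ' → boundary s δ δ' ≡ m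
boundary-between {s} {δ} {δ'} {m} lo hi sm≡ sx≢ with δ + δ' ≤? (m - 1ℤ) + (m - 1ℤ)
... | yes at-lo = begin
  boundary s δ δ'     ≡⟨ boundary≡midpoint+1 s δ δ' (subst (λ β → s β ≢ β - δ') (sym β≡) sx≢) ⟩
  midpoint δ δ' + 1ℤ  ≡⟨ cong (_+ 1ℤ) β≡ ⟩
  m - 1ℤ + 1ℤ         ≡⟨ solve (m ∷ []) ⟩
  m                   ∎
  where
  β≡ : midpoint δ δ' ≡ m - 1ℤ
  β≡ = ceil-half-unique (δ + δ') (m - 1ℤ) (≤-trans (i-j≤i _ 1ℤ) lo) at-lo
... | no above-lo =
  trans (boundary≡midpoint s δ δ' (subst (λ β → s β ≡ β - δ') (sym β≡) sm≡)) β≡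
  where
  β≡ : midpoint δ δ' ≡ m
  β≡ = ceil-half-unique (δ + δ') m
    (≤-by (m + m - 1ℤ) (δ + δ') (gap< (≰⇒> above-lo)) (solve (m ∷ δ ∷ δ' ∷ []))) hi

boundaryAbove : LinkOffsets → (ℤ → ℤ) → ℤ → ℤ
boundaryAbove Δ s δ = boundary s δ (nextAbove (offs Δ) δ)

boundaryAbove-nextUp : ∀ {Δ} s {δ δ'} → NextUp Δ δ δ' → boundaryAbove Δ s δ ≡ boundary s δ δ'
boundaryAbove-nextUp {Δ} s {δ} δ→δ' = cong (boundary s δ) (nextAbove-nextUp {Δ} δ→δ')

boundaryAbove-cases : ∀ Δ s δ δ' → NextUp Δ δ δ'
  → boundaryAbove Δ s δ ≡ midpoint δ δ' ⊎ boundaryAbove Δ s δ ≡ midpoint δ δ' + 1ℤ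
boundaryAbove-cases Δ s δ δ' δ→δ' rewrite boundaryAbove-nextUp {Δ} s δ→δ' = boundary-cases s δ δ'

-- Minima of positive intervals

MinimumCases : Mode → LinkOffsets → (ℤ → ℤ) → ℤ → ℤ → Set
MinimumCases mode Δ c a m =
  m ≡ a
  ⊎ (∃[ δ ] (δ ∈ offs Δ × 0ℤ < δ × (m ≡ δ ⊎ m ≡ δ + 1ℤ)))
  ⊎ (TwoSided mode × ∃[ δ ] ∃[ δ' ] (0ℤ < δ × NextUp Δ δ δ' × m ≡ c δ))

MinimaCandidates : Mode → LinkOffsets → (ℤ → ℤ) → ℤ → ℤ → Set
MinimaCandidates mode Δ s a b = Σ (ℤ → ℤ) (λ c
  → (∀ δ δ' → 0ℤ < δ → NextUp Δ δ δ' → c δ ≡ ⌈ δ + δ' /2⌉ ⊎ c δ ≡ ⌈ δ + δ' /2⌉ + 1ℤ)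
  × (∀ m → InMmin Δ a b s m → InS a b m × MinimumCases mode Δ c a m))

module Minima (Δ : LinkOffsets) (s : ℤ → ℤ) {a b : ℤ} (1≤a : 1ℤ ≤ a) where

  OffsetOrSuc : ℤ → Set
  OffsetOrSuc m = ∃[ δ ] (δ ∈ offs Δ × 0ℤ < δ × (m ≡ δ ⊎ m ≡ δ + 1ℤ))

  BoundaryPoint : ℤ → Set
  BoundaryPoint m = ∃[ δ ] ∃[ δ' ] (0ℤ < δ × NextUp Δ δ δ' × m ≡ boundaryAbove Δ s δ)

  MinimumOf : ℤ → Sgn → ℤ → Set
  MinimumOf δ σ m = InSΔ a b s δ σ m × (∀ y → InSΔ a b s δ σ y → m ≤ y)

  positive : ∀ {x} → a ≤ x → 0ℤ < x
  positive a≤x = suc[i]≤j⇒i<j {0ℤ} (≤-trans 1≤a a≤x)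

  a≤m-1 : ∀ {m} → a < m → a ≤ m - 1ℤ
  a≤m-1 {m} a<m = ≤-by a (m - 1ℤ) (gap< a<m) (solve (a ∷ m ∷ []))

  predecessor-∈ : ∀ {m} → a < m → InS a b m → InS a b (m - 1ℤ)
  predecessor-∈ {m} a<m (_ , m≤b) = a≤m-1 a<m , ≤-trans (i-j≤i m 1ℤ) m≤b

  below-offset : ∀ {δ m} → InSΔ a b s δ neg m → m < δ
  below-offset {δ} {m} (_ , sm≡ , sm<0) = i-j<0⇒i<j {m} {δ} (subst (_< 0ℤ) sm≡ sm<0)

  predecessor-outside : ∀ {δ σ m} → MinimumOf δ σ m → a < m
    → s (m - 1ℤ) ≡ m - 1ℤ - δ → HasSgn (m - 1ℤ - δ) σ → ⊥
  predecessor-outside {δ} {σ} {m} ((m∈ , _) , least) a<m sx≡ sgn =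
    <⇒≱ (m-1<m m)
        (least (m - 1ℤ) (predecessor-∈ a<m m∈ , sx≡ , subst (λ z → HasSgn z σ) (sym sx≡) sgn))

  offset-hit : ∀ {δ m} → δ ∈ offs Δ → MinimumOf δ zer m → OffsetOrSuc m
  offset-hit {δ} {m} δ∈ (((a≤m , _) , sm≡ , sm≡0) , _) =
    δ , δ∈ , subst (0ℤ <_) m≡δ (positive a≤m) , inj₁ m≡δ
    where
    m≡δ : m ≡ δ
    m≡δ = i-j≡0⇒i≡j m δ (trans (sym sm≡) sm≡0)

  past-offset : ∀ {δ m} → δ ∈ offs Δ → a < m → m - 1ℤ ≡ δ → OffsetOrSuc m
  past-offset {δ} {m} δ∈ a<m m-1≡δ =
    δ , δ∈ , subst (0ℤ <_) m-1≡δ (positive (a≤m-1 a<m)) , inj₂ (begin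
      m            ≡⟨ solve (m ∷ []) ⟩
      m - 1ℤ + 1ℤ  ≡⟨ cong (_+ 1ℤ) m-1≡δ ⟩
      δ + 1ℤ       ∎)

  predecessor-same-offset : ∀ mode {δ m} → GreedyOn mode Δ s a b → δ ∈ offs Δ → InS a b m
    → s m ≡ m - δ → a < m → δ ≤ m - 1ℤ → s (m - 1ℤ) ≡ m - 1ℤ - δ
  predecessor-same-offset mode {δ} {m} G δ∈ m∈ sm≡ a<m δ≤x
    with greedyStep-offset mode {Δ} {m - 1ℤ} (G (m - 1ℤ) (predecessor-∈ a<m m∈))
  ... | δ₀ , δ₀∈ , sx≡ = trans sx≡ (cong (λ d → m - 1ℤ - d) (same mode G))
    where
    x∈ : InS a b (m - 1ℤ)
    x∈ = predecessor-∈ a<m m∈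
    same : ∀ mode → GreedyOn mode Δ s a b → δ₀ ≡ δ
    same oneSided G = largestBelow-unique {Δ} (i-j≤i m 1ℤ) δ≤x δ₀∈ δ∈
      (oneSided-largestBelow {Δ} (positive (proj₁ x∈)) (G (m - 1ℤ) x∈) sx≡)
      (oneSided-largestBelow {Δ} (positive (proj₁ m∈)) (G m m∈) sm≡)
    same twoSided G = nearest-unique {Δ} (m-1<m m) δ≤x δ₀∈ δ∈
      (twoSided-nearest {Δ} (G (m - 1ℤ) x∈) sx≡) (twoSided-nearest {Δ} (G m m∈) sm≡)

  twoSided-boundary : ∀ {δ δ₀ m} → GreedyOn twoSided Δ s a b → δ ∈ offs Δ
    → MinimumOf δ neg m → a < m → δ₀ ∈ offs Δ → s (m - 1ℤ) ≡ m - 1ℤ - δ₀ → δ₀ ≢ δ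
    → BoundaryPoint m
  twoSided-boundary {δ} {δ₀} {m} G δ∈ (m∈Sδ@(m∈ , sm≡ , _) , _) a<m δ₀∈ sx≡ δ₀≢δ =
    δ₀ , δ , 0<δ₀ , next ,
    sym (trans (boundaryAbove-nextUp {Δ} s next) (boundary-between {s} {δ₀} {δ} {m} lo hi sm≡ sx≢))
    where
    x∈ : InS a b (m - 1ℤ)
    x∈ = predecessor-∈ a<m m∈
    near-x : Nearest Δ (m - 1ℤ) δ₀
    near-x = twoSided-nearest {Δ} (G (m - 1ℤ) x∈) sx≡
    near-m : Nearest Δ m δ
    near-m = twoSided-nearest {Δ} (G m m∈) sm≡
    m<δ : m < δ
    m<δ = below-offset m∈Sδ
    bounds : δ₀ < δ × (m - 1ℤ) + (m - 1ℤ) ≤ δ₀ + δ × δ₀ + δ ≤ m + m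
    bounds = nearest-switch {Δ} (≤-trans (i-j≤i m 1ℤ) (<⇒≤ m<δ)) δ₀≢δ δ₀∈ δ∈ near-x near-m
    lo : (m - 1ℤ) + (m - 1ℤ) ≤ δ₀ + δ
    lo = proj₁ (proj₂ bounds)
    hi : δ₀ + δ ≤ m + m
    hi = proj₂ (proj₂ bounds)
    next : NextUp Δ δ₀ δ
    next = δ₀∈ , δ∈ , proj₁ bounds , nearest-switch-adjacent {Δ} m<δ near-x near-m
    0<δ₀ : 0ℤ < δ₀
    0<δ₀ = suc[i]≤j⇒i<j {0ℤ}
      (proj₁ (closer-than-below (≤-trans 1≤a (proj₁ x∈)) (closest near-x 1ℤ (has+1 Δ))))
    sx≢ : s (m - 1ℤ) ≢ m - 1ℤ - δ
    sx≢ e = δ₀≢δ (sub-cancelˡ (m - 1ℤ) (trans (sym sx≡) e))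

  classify : ∀ mode σ {δ m} → GreedyOn mode Δ s a b → δ ∈ offs Δ → MinimumOf δ σ m → a < m
    → OffsetOrSuc m ⊎ (TwoSided mode × BoundaryPoint m)
  classify mode zer G δ∈ minimum a<m = inj₁ (offset-hit δ∈ minimum)
  classify mode pos {δ} {m} G δ∈ minimum@((m∈ , sm≡ , 0<sm) , _) a<m with m - 1ℤ ≟ δ
  ... | yes m-1≡δ = inj₁ (past-offset δ∈ a<m m-1≡δ)
  ... | no m-1≢δ = ⊥-elim (predecessor-outside {δ} {pos} {m} minimum a<m
        (predecessor-same-offset mode {m = m} G δ∈ m∈ sm≡ a<m (<⇒≤ δ<x)) (0<j-i δ<x))
    where
    δ<x : δ < m - 1ℤ
    δ<x = ≤∧≢⇒< (≤-by δ (m - 1ℤ) (gap< (subst (0ℤ <_) sm≡ 0<sm)) (solve (m ∷ δ ∷ [])))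
                (≢-sym m-1≢δ)
  classify oneSided neg {m = m} G δ∈ (m∈Sδ@(m∈ , sm≡ , _) , _) a<m =
    ⊥-elim (<⇒≱ (below-offset m∈Sδ)
                (below (oneSided-largestBelow {Δ} (positive (proj₁ m∈)) (G m m∈) sm≡)))
  classify twoSided neg {δ} {m} G δ∈ minimum@(m∈Sδ@(m∈ , _) , _) a<m
    with greedyStep-offset twoSided {Δ} {m - 1ℤ} (G (m - 1ℤ) (predecessor-∈ a<m m∈))
  ... | δ₀ , δ₀∈ , sx≡ with δ₀ ≟ δ
  ...   | no δ₀≢δ = inj₂ (refl , twoSided-boundary {m = m} G δ∈ minimum a<m δ₀∈ sx≡ δ₀≢δ)
  ...   | yes refl = ⊥-elim (predecessor-outside {δ} {neg} {m} minimum a<m sx≡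
          (<-by (m - 1ℤ - δ) 0ℤ (gap (<⇒≤ (below-offset m∈Sδ))) (solve (m ∷ δ ∷ []))))

  minima : ∀ mode → GreedyOn mode Δ s a b → ∀ m → InMmin Δ a b s m
    → InS a b m × MinimumCases mode Δ (boundaryAbove Δ s) a m
  minima mode G m (δ , σ , δ∈ , m∈Sδσ , least) with m ≟ a
  ... | yes m≡a = proj₁ m∈Sδσ , inj₁ m≡a
  ... | no m≢a = proj₁ m∈Sδσ , inj₂ (classify mode σ G δ∈ (m∈Sδσ , least) a<m)
    where
    a<m : a < m
    a<m = ≤∧≢⇒< (proj₁ (proj₁ m∈Sδσ)) (≢-sym m≢a)

minimaCandidates : ∀ mode Δ s {a b} → 1ℤ ≤ a → GreedyOn mode Δ s a b
  → MinimaCandidates mode Δ s a b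
minimaCandidates mode Δ s 1≤a G =
  boundaryAbove Δ s , (λ δ δ' _ → boundaryAbove-cases Δ s δ δ') , Minima.minima Δ s 1≤a mode G

-- Mirroring: maxima of negative intervals

mirror : LinkOffsets → LinkOffsets
offs (mirror Δ) = map (-_) (offs Δ)
no-zero (mirror Δ) 0∈ with ∈-map⁻ (-_) 0∈
... | δ , δ∈ , 0≡-δ = no-zero Δ (subst (_∈ offs Δ) (sym (neg-injective 0≡-δ)) δ∈)
has+1 (mirror Δ) = ∈-map⁺ (-_) (has-1 Δ)
has-1 (mirror Δ) = ∈-map⁺ (-_) (has+1 Δ)

∈-mirror⁺ : ∀ {Δ δ} → δ ∈ offs Δ → - δ ∈ offs (mirror Δ)
∈-mirror⁺ = ∈-map⁺ (-_)

∈-mirror⁻ : ∀ {Δ δ} → δ ∈ offs (mirror Δ) → - δ ∈ offs Δ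
∈-mirror⁻ {Δ} δ∈ with ∈-map⁻ (-_) δ∈
... | e , e∈ , refl = subst (_∈ offs Δ) (sym (neg-involutive e)) e∈

mirrorSucc : (ℤ → ℤ) → ℤ → ℤ
mirrorSucc s x = - s (- x)

mirrorSgn : Sgn → Sgn
mirrorSgn neg = pos
mirrorSgn zer = zer
mirrorSgn pos = neg

hasSgn-neg : ∀ {z} σ → HasSgn z σ → HasSgn (- z) (mirrorSgn σ)
hasSgn-neg neg z<0 = neg-mono-< z<0
hasSgn-neg zer z≡0 = cong -_ z≡0
hasSgn-neg pos 0<z = neg-mono-< 0<z

hasSgn-neg⁻ : ∀ {z} σ → HasSgn (- z) (mirrorSgn σ) → HasSgn z σ
hasSgn-neg⁻ {z} neg 0<-z = neg-cancel-< {0ℤ} {z} 0<-z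
hasSgn-neg⁻ {z} zer -z≡0 = neg-injective {z} {0ℤ} -z≡0
hasSgn-neg⁻ {z} pos -z<0 = neg-cancel-< {z} {0ℤ} -z<0

greedyStep-mirror : ∀ mode {Δ x y} → GreedyStep mode Δ x y
  → GreedyStep mode (mirror Δ) (- x) (- y)
greedyStep-mirror oneSided {Δ} {x} {y} ((δ , δ∈ , y≡) , positive-x , negative-x) =
  (- δ , ∈-mirror⁺ {Δ} δ∈ , trans (cong -_ y≡) (neg-sub x δ)) , positive-mirror , negative-mirror
  where
  positive-mirror : 0ℤ < - x
    → 0ℤ ≤ - y × (∀ e → e ∈ offs (mirror Δ) → 0ℤ ≤ - x - e → - y ≤ - x - e)
  positive-mirror 0<-x with negative-x (neg-cancel-< {0ℤ} {x} 0<-x)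
  ... | y≤0 , maximal = neg-mono-≤ y≤0 , λ e e∈ 0≤-x-e →
    subst (- y ≤_) (neg-sub-neg x e)
      (neg-mono-≤ (maximal (- e) (∈-mirror⁻ {Δ} e∈)
        (neg-cancel-≤ {0ℤ} {x - - e} (subst (0ℤ ≤_) (sym (neg-sub-neg x e)) 0≤-x-e))))
  negative-mirror : - x < 0ℤ
    → - y ≤ 0ℤ × (∀ e → e ∈ offs (mirror Δ) → - x - e ≤ 0ℤ → - x - e ≤ - y)
  negative-mirror -x<0 with positive-x (neg-cancel-< {x} {0ℤ} -x<0)
  ... | 0≤y , minimal = neg-mono-≤ 0≤y , λ e e∈ -x-e≤0 →
    subst (_≤ - y) (neg-sub-neg x e)
      (neg-mono-≤ (minimal (- e) (∈-mirror⁻ {Δ} e∈)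
        (neg-cancel-≤ {x - - e} {0ℤ} (subst (_≤ 0ℤ) (sym (neg-sub-neg x e)) -x-e≤0))))
greedyStep-mirror twoSided {Δ} {x} {y} ((δ , δ∈ , y≡) , shortest) =
  (- δ , ∈-mirror⁺ {Δ} δ∈ , trans (cong -_ y≡) (neg-sub x δ)) ,
  λ e e∈ → subst₂ ℕ._≤_ (sym (∣-i∣≡∣i∣ y))
                        (trans (sym (∣-i∣≡∣i∣ (x - - e))) (cong ∣_∣ (neg-sub-neg x e)))
                        (shortest (- e) (∈-mirror⁻ {Δ} e∈))

inS-mirror : ∀ {a b x} → InS a b x → InS (- b) (- a) (- x)
inS-mirror (a≤x , x≤b) = neg-mono-≤ x≤b , neg-mono-≤ a≤x

inS-mirror⁻ : ∀ {a b x} → InS (- b) (- a) (- x) → InS a b x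
inS-mirror⁻ (-b≤-x , -x≤-a) = neg-cancel-≤ -x≤-a , neg-cancel-≤ -b≤-x

inS-mirror-neg : ∀ {a b x} → InS (- b) (- a) x → InS a b (- x)
inS-mirror-neg {a} {b} {x} x∈ =
  inS-mirror⁻ (subst (InS (- b) (- a)) (sym (neg-involutive x)) x∈)

greedyOn-mirror : ∀ {mode Δ s a b} → GreedyOn mode Δ s a b
  → GreedyOn mode (mirror Δ) (mirrorSucc s) (- b) (- a)
greedyOn-mirror {mode} {Δ} {s} G x x∈ =
  subst (λ z → GreedyStep mode (mirror Δ) z (mirrorSucc s x)) (neg-involutive x)
        (greedyStep-mirror mode (G (- x) (inS-mirror-neg x∈)))

inSΔ-mirror : ∀ {a b s δ σ y} → InSΔ a b s δ σ y
  → InSΔ (- b) (- a) (mirrorSucc s) (- δ) (mirrorSgn σ) (- y)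
inSΔ-mirror {s = s} {δ} {σ} {y} (y∈ , sy≡ , sgn) =
  inS-mirror y∈ ,
  trans s-y (trans (cong -_ sy≡) (neg-sub y δ)) ,
  subst (λ z → HasSgn z (mirrorSgn σ)) (sym s-y) (hasSgn-neg σ sgn)
  where
  s-y : mirrorSucc s (- y) ≡ - s y
  s-y = cong (λ z → - s z) (neg-involutive y)

inSΔ-mirror⁻ : ∀ {a b s δ σ y} → InSΔ (- b) (- a) (mirrorSucc s) (- δ) (mirrorSgn σ) y
  → InSΔ a b s δ σ (- y)
inSΔ-mirror⁻ {s = s} {δ} {σ} {y} (y∈ , sy≡ , sgn) =
  inS-mirror-neg y∈ ,
  (begin
    s (- y)      ≡⟨ neg-swap sy≡ ⟩
    - (y - - δ)  ≡⟨ neg-sub-neg y δ ⟩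
    - y - δ      ∎) ,
  hasSgn-neg⁻ σ sgn

inMmax-mirror : ∀ {Δ a b s m} → InMmax Δ a b s m
  → InMmin (mirror Δ) (- b) (- a) (mirrorSucc s) (- m)
inMmax-mirror {Δ} {a} {b} {s} {m} (δ , σ , δ∈ , m∈ , greatest) =
  - δ , mirrorSgn σ , ∈-mirror⁺ {Δ} δ∈ , inSΔ-mirror {a} {b} {s} m∈ , least
  where
  least : ∀ y → InSΔ (- b) (- a) (mirrorSucc s) (- δ) (mirrorSgn σ) y → - m ≤ y
  least y y∈ =
    subst (- m ≤_) (neg-involutive y) (neg-mono-≤ (greatest (- y) (inSΔ-mirror⁻ {a} {b} {s} y∈)))

nextDown-mirror : ∀ {Δ δ δ'} → NextDown Δ δ δ' → NextUp (mirror Δ) (- δ) (- δ')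
nextDown-mirror {Δ} (δ∈ , δ'∈ , δ'<δ , gapless) =
  ∈-mirror⁺ {Δ} δ∈ , ∈-mirror⁺ {Δ} δ'∈ , neg-mono-< δ'<δ ,
  λ e e∈ -δ<e e<-δ' → gapless (- e) (∈-mirror⁻ {Δ} e∈) (<-neg e<-δ') (neg-< -δ<e)

nextUp-mirror⁻ : ∀ {Δ δ δ'} → NextUp (mirror Δ) δ δ' → NextDown Δ (- δ) (- δ')
nextUp-mirror⁻ {Δ} (δ∈ , δ'∈ , δ<δ' , gapless) =
  ∈-mirror⁻ {Δ} δ∈ , ∈-mirror⁻ {Δ} δ'∈ , neg-mono-< δ<δ' ,
  λ e e∈ -δ'<e e<-δ → gapless (- e) (∈-mirror⁺ {Δ} e∈) (<-neg e<-δ) (neg-< -δ'<e)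

MaximumCases : Mode → LinkOffsets → (ℤ → ℤ) → ℤ → ℤ → Set
MaximumCases mode Δ c b m =
  m ≡ b
  ⊎ (∃[ δ ] (δ ∈ offs Δ × δ < 0ℤ × (m ≡ δ ⊎ m ≡ δ - 1ℤ)))
  ⊎ (TwoSided mode × ∃[ δ ] ∃[ δ' ] (δ < 0ℤ × NextDown Δ δ δ' × m ≡ c δ))

MaximaCandidates : Mode → LinkOffsets → (ℤ → ℤ) → ℤ → ℤ → Set
MaximaCandidates mode Δ s a b = Σ (ℤ → ℤ) (λ c
  → (∀ δ δ' → δ < 0ℤ → NextDown Δ δ δ' → c δ ≡ ⌊ δ + δ' /2⌋ ⊎ c δ ≡ ⌊ δ + δ' /2⌋ - 1ℤ)
  × (∀ m → InMmax Δ a b s m → InS a b m × MaximumCases mode Δ c b m))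

maximumCases-mirror⁻ : ∀ {mode Δ c b m} → MinimumCases mode (mirror Δ) c (- b) (- m)
  → MaximumCases mode Δ (λ δ → - c (- δ)) b m
maximumCases-mirror⁻ (inj₁ -m≡-b) = inj₁ (neg-injective -m≡-b)
maximumCases-mirror⁻ {Δ = Δ} (inj₂ (inj₁ (δ , δ∈ , 0<δ , hit))) =
  inj₂ (inj₁ (- δ , ∈-mirror⁻ {Δ} δ∈ , neg-mono-< 0<δ ,
    Sum.map neg-swap (λ e → trans (neg-swap e) (neg-distrib-+ δ 1ℤ)) hit))
maximumCases-mirror⁻ {Δ = Δ} {c} (inj₂ (inj₂ (two , δ , δ' , 0<δ , δ→δ' , -m≡))) =
  inj₂ (inj₂ (two , - δ , - δ' , neg-mono-< 0<δ , nextUp-mirror⁻ {Δ} δ→δ' ,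
    trans (neg-swap -m≡) (cong (λ z → - c z) (sym (neg-involutive δ)))))

maxima-from-mirror : ∀ {mode Δ s a b}
  → MinimaCandidates mode (mirror Δ) (mirrorSucc s) (- b) (- a) → MaximaCandidates mode Δ s a b
maxima-from-mirror {mode} {Δ} {s} {a} {b} (c , c-cases , classify) =
  (λ δ → - c (- δ)) ,
  (λ δ δ' δ<0 δ→δ' → Sum.map
    (λ e → trans (cong -_ e) (neg-⌈neg/2⌉ δ δ'))
    (λ e → trans (cong -_ e)
                 (trans (neg-distrib-+ ⌈ - δ + - δ' /2⌉ 1ℤ) (cong (_- 1ℤ) (neg-⌈neg/2⌉ δ δ'))))
    (c-cases (- δ) (- δ') (neg-mono-< δ<0) (nextDown-mirror {Δ} δ→δ'))) ,
  (λ m m∈M → Prod.map (inS-mirror⁻ {a} {b} {m}) (maximumCases-mirror⁻ {mode} {Δ} {c} {b} {m})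
                      (classify (- m) (inMmax-mirror {Δ} {a} {b} {s} {m} m∈M)))

maximaCandidates : ∀ mode Δ s {a b} → b < 0ℤ → GreedyOn mode Δ s a b
  → MaximaCandidates mode Δ s a b
maximaCandidates mode Δ s {a} {b} b<0 G =
  maxima-from-mirror {mode} {Δ} {s} {a} {b}
    (minimaCandidates mode (mirror Δ) (mirrorSucc s) {a = - b} {b = - a}
      (i<j⇒suc[i]≤j {0ℤ} { - b} (neg-mono-< b<0)) (greedyOn-mirror {mode} {Δ} {s} {a} {b} G))

lemma5 : (mode : Mode) (Δ : LinkOffsets) (s : ℤ → ℤ) (a b : ℤ)
    → ((1ℤ ≤ a × a ≤ b × (∀ x → InS a b x → GreedyStep mode Δ x (s x)))
       → Σ (ℤ → ℤ) (λ c
           → (∀ δ δ' → 0ℤ < δ → NextUp Δ δ δ'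
                → c δ ≡ ⌈ δ + δ' /2⌉ ⊎ c δ ≡ ⌈ δ + δ' /2⌉ + 1ℤ)
           × (∀ m → InMmin Δ a b s m
                → InS a b m
                  × (m ≡ a
                     ⊎ (∃[ δ ] (δ ∈ offs Δ × 0ℤ < δ × (m ≡ δ ⊎ m ≡ δ + 1ℤ)))
                     ⊎ (TwoSided mode
                        × ∃[ δ ] ∃[ δ' ] (0ℤ < δ × NextUp Δ δ δ' × m ≡ c δ))))))
    × ((a ≤ b × b < 0ℤ × (∀ x → InS a b x → GreedyStep mode Δ x (s x)))
       → Σ (ℤ → ℤ) (λ c
           → (∀ δ δ' → δ < 0ℤ → NextDown Δ δ δ'
                → c δ ≡ ⌊ δ + δ' /2⌋ ⊎ c δ ≡ ⌊ δ + δ' /2⌋ - 1ℤ)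
           × (∀ m → InMmax Δ a b s m
                → InS a b m
                  × (m ≡ b
                     ⊎ (∃[ δ ] (δ ∈ offs Δ × δ < 0ℤ × (m ≡ δ ⊎ m ≡ δ - 1ℤ)))
                     ⊎ (TwoSided mode
                        × ∃[ δ ] ∃[ δ' ] (δ < 0ℤ × NextDown Δ δ δ' × m ≡ c δ))))))
lemma5 mode Δ s a b =
  (λ (1≤a , _ , G) → minimaCandidates mode Δ s 1≤a G) ,
  (λ (_ , b<0 , G) → maximaCandidates mode Δ s b<0 G)
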